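{- Let $f$ be a function such that for all integers $k,\ell\geq 1$, every finite digraph $G$ with $\delta^+(G)\geq f(k,\ell)$ contains $S^-_{k,\ell}$ as a subgraph. Let $k\geq 1$ and $\ell\geq 2$. Then every finite digraph $G$ with $\delta^+(G)\geq f(k,3k\ell^{k+1})+2k\ell^k$ contains $T(k,\ell)$ as a subgraph.
   Context: All digraphs are finite, without loops or multiple copies of the same edge (two oppositely oriented edges between a pair of vertices are allowed). $\delta^+(G)$ is the minimum out-degree of $G$. $S^-_{k,\ell}$ is the $(k-1)$-subdivision of the in-star with $\ell$ leaves, i.e. a centre vertex with $\ell$ directed paths of length $k$ ending at it, pairwise disjoint except at the centre. (Such a function $f$ exists by a result of Aboulker et al.) $B^+_{k,\ell}$ is the complete $\ell$-ary tree of depth $k$ with all edges oriented away from the root. $T(k,\ell)$ is the oriented tree obtained from $B^+_{k,\ell}$ by identifying each leaf with the centre of a new (disjoint) copy of $S^-_{k,\ell}$. -}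

module Defs where

open import Data.Nat using (ℕ; zero; suc; _+_; _*_; _^_; _≤_; _<_)
open import Data.Fin using (Fin)
open import Data.Bool using (Bool; true; false; if_then_else_)
open import Data.List using (List; []; _∷_; length; map; allFin)
open import Data.Nat.ListAction using (sum)
open import Data.Product using (Σ; _×_; _,_)
open import Function.Definitions using (Injective)
open import Relation.Binary.PropositionalEquality using (_≡_)

-- A finite digraph on vertex set Fin n (n ≥ 1), given by a Boolean adjacency
-- relation: adj u v ≡ true means there is an edge u → v.  No loops; the two
-- opposite edges u → v, v → u may both be present; no multi-edges (by design).
record Digraph : Set where
  field
    n        : ℕ
    nonempty : 0 < n
    adj      : Fin n → Fin n → Bool
    loopless : ∀ v → adj v v ≡ false
open Digraph public

outdeg : (G : Digraph) → Fin (n G) → ℕ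
outdeg G u = sum (map (λ v → if adj G u v then 1 else 0) (allFin (n G)))

MinOutDeg≥ : Digraph → ℕ → Set
MinOutDeg≥ G d = ∀ u → d ≤ outdeg G u

Contains : (G : Digraph) (V : Set) (E : V → V → Set) → Set
Contains G V E =
  Σ (V → Fin (n G)) λ φ → Injective _≡_ _≡_ φ × (∀ {u v} → E u v → adj G (φ u) (φ v) ≡ true)

-- S⁻_{k,ℓ}: centre, and ℓ arms; arm i consists of vertices (i , j) for
-- j < k, where (i , j) is at distance j+1 from the centre.
-- Edges: (i , 0) → centre,  (i , j+1) → (i , j).

data SV (k ℓ : ℕ) : Set where
  centre : SV k ℓ
  arm    : (i : Fin ℓ) (j : ℕ) → j < k → SV k ℓ

data SE (k ℓ : ℕ) : SV k ℓ → SV k ℓ → Set where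
  toCentre : ∀ i (p : 0 < k) → SE k ℓ (arm i 0 p) centre
  step     : ∀ i j (p : suc j < k) (q : j < k) → SE k ℓ (arm i (suc j) p) (arm i j q)

-- T(k,ℓ): the out-tree B⁺_{k,ℓ} has vertices the words over Fin ℓ of length
-- ≤ k (root = empty word), with edges w → a ∷ w.  Each leaf w (length k) is
-- identified with the centre of its own copy of S⁻_{k,ℓ}, whose non-centre
-- vertices are  leg w _ i j  (i < ℓ, j < k).

data TV (k ℓ : ℕ) : Set where
  node : (w : List (Fin ℓ)) → length w ≤ k → TV k ℓ
  leg  : (w : List (Fin ℓ)) → length w ≡ k → (i : Fin ℓ) (j : ℕ) → j < k → TV k ℓ

data TE (k ℓ : ℕ) : TV k ℓ → TV k ℓ → Set where
  tree    : ∀ w a (p : length w ≤ k) (q : length (a ∷ w) ≤ k) →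
            TE k ℓ (node w p) (node (a ∷ w) q)
  toLeaf  : ∀ w (e : length w ≡ k) i (p : 0 < k) (r : length w ≤ k) →
            TE k ℓ (leg w e i 0 p) (node w r)
  legStep : ∀ w (e : length w ≡ k) i j (p : suc j < k) (q : j < k) →
            TE k ℓ (leg w e i (suc j) p) (leg w e i j q)

{-# OPTIONS --safe #-}
-- Keep a list C of centres of copies of S⁻_{k,L}, L = 3kℓ^{k+1}, and layer the vertices:
-- layer 0 is C, and layer j + 1 consists of the vertices with at least t = |B⁺_{k,ℓ}|
-- out-neighbours in layer j.  From a vertex of layer k, a copy of B⁺_{k,ℓ} with leaves
-- in C can be grown greedily, and then ℓ arms of the star at each leaf chosen greedily
-- as legs, since L exceeds the number of vertices used; this gives T(k,ℓ).  If layer k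
-- is empty, a vertex outside layers 0, …, k − 1 sends fewer than t edges into each of
-- them, so these vertices induce a subgraph of minimum out-degree f(k,L) (as
-- k·t ≤ 2kℓ^k), nonempty by a shifting argument on the layers; its star has a centre
-- outside C.  Adding that centre to C and repeating, layer k is reached within |G| rounds.
module Submission where

open import Defs
open import Data.Nat using (ℕ; zero; suc; _+_; _*_; _^_; _≤_; _<_; _≤ᵇ_; _≤?_; z≤n; s≤s)
open import Data.Nat.Properties
open import Data.Nat.ListAction using (sum)
open import Data.Nat.Tactic.RingSolver using (solve-∀)
open import Data.Fin using (Fin; zero; suc; toℕ; fromℕ<)
import Data.Fin.Properties as Fin
open import Data.Bool using (Bool; true; false; T; T?; not; _∧_; _∨_; if_then_else_)
open import Data.Bool.Properties using (T-∧; T-∨; T-≡; ∨-identityʳ)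
open import Data.Unit using (⊤; tt)
open import Data.Empty using (⊥-elim)
open import Data.Sum using (inj₁; inj₂)
open import Data.Product using (Σ; ∃; _×_; _,_; proj₁; proj₂)
open import Data.List using (List; []; _∷_; _++_; length; map; lookup; tabulate; allFin; filterᵇ; reverse)
import Data.List.Properties as List
open import Data.List.Membership.Propositional using (_∈_; _∉_; find)
open import Data.List.Membership.Propositional.Properties
  using (∈-lookup; ∈-allFin; ∈-++⁺ˡ; ∈-++⁺ʳ; ∈-++⁻; ∈-filter⁺; ∈-filter⁻; ∈-map⁺; ∈-map⁻)
open import Data.List.Relation.Unary.Any using (here; there; index)
import Data.List.Relation.Unary.Any as Any
open import Data.List.Relation.Unary.Any.Properties using (lookup-index)
open import Data.List.Relation.Unary.All using (All; []; _∷_)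
import Data.List.Relation.Unary.All as All
open import Data.List.Relation.Unary.All.Properties using (¬All⇒Any¬; ¬Any⇒All¬)
open import Data.List.Relation.Unary.AllPairs using ([]; _∷_)
open import Data.List.Relation.Unary.Unique.Propositional using (Unique)
import Data.List.Relation.Unary.Unique.Propositional.Properties as Unique
open import Data.List.Relation.Binary.Disjoint.Propositional using (Disjoint)
open import Data.List.Relation.Binary.Disjoint.Propositional.Properties using () renaming (sym to Disjoint-sym)
open import Function using (_∘_; Equivalence)
open import Function.Definitions using (Injective)
open import Relation.Binary.Definitions using (DecidableEquality)
open import Relation.Binary.PropositionalEquality
open import Relation.Nullary using (¬_; yes; no; isYes; contradiction)
open import Relation.Nullary.Decidable using (decidable-stable; toWitness; fromWitness)

∨-introˡ : ∀ {a} b → T a → T (a ∨ b)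
∨-introˡ {true} _ _ = tt

∨-introʳ : ∀ a {b} → T b → T (a ∨ b)
∨-introʳ true  _  = tt
∨-introʳ false tb = tb

T-not⇒¬T : ∀ {b} → T (not b) → ¬ T b
T-not⇒¬T {false} _ ()

¬T-not⇒T : ∀ {b} → ¬ T (not b) → T b
¬T-not⇒T {true}  _  = tt
¬T-not⇒T {false} ¬t = ¬t tt

not-∧-absurd : ∀ {b c} → T b → ¬ T (not b ∧ c)
not-∧-absurd {true} _ ()

module _ {A : Set} where

  count : (A → Bool) → List A → ℕ
  count P xs = length (filterᵇ P xs)

  sum-indicator≡count : ∀ (P : A → Bool) xs → sum (map (λ x → if P x then 1 else 0) xs) ≡ count P xs
  sum-indicator≡count P [] = refl
  sum-indicator≡count P (x ∷ xs) with P x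
  ... | true  = cong suc (sum-indicator≡count P xs)
  ... | false = sum-indicator≡count P xs

  count-⇒∨ : ∀ {P Q R : A → Bool} xs → (∀ x → T (P x) → T (Q x ∨ R x)) →
             count P xs ≤ count Q xs + count R xs
  count-⇒∨ [] _ = z≤n
  count-⇒∨ {P} {Q} {R} (x ∷ xs) h with P x | Q x | R x | h x | count-⇒∨ {P} {Q} {R} xs h
  ... | false | false | false | _  | ih = ih
  ... | false | false | true  | _  | ih = ≤-trans ih (+-monoʳ-≤ _ (n≤1+n _))
  ... | false | true  | false | _  | ih = m≤n⇒m≤1+n ih
  ... | false | true  | true  | _  | ih = m≤n⇒m≤1+n (≤-trans ih (+-monoʳ-≤ _ (n≤1+n _)))
  ... | true  | true  | false | _  | ih = s≤s ih
  ... | true  | true  | true  | _  | ih = s≤s (≤-trans ih (+-monoʳ-≤ _ (n≤1+n _)))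
  ... | true  | false | true  | _  | ih = ≤-trans (s≤s ih) (≤-reflexive (sym (+-suc _ _)))
  ... | true  | false | false | h′ | _  = ⊥-elim (h′ _)

  count-none : ∀ {P : A → Bool} xs → (∀ x → ¬ T (P x)) → count P xs ≡ 0
  count-none {P} xs none = cong length (List.filter-none (T? ∘ P) {xs} (All.tabulate λ {x} _ → none x))

  count-filterᵇ : ∀ (P W : A → Bool) xs → count P (filterᵇ W xs) ≡ count (λ x → W x ∧ P x) xs
  count-filterᵇ P W [] = refl
  count-filterᵇ P W (x ∷ xs) with W x
  ... | false = count-filterᵇ P W xs
  ... | true with P x
  ...   | true  = cong suc (count-filterᵇ P W xs)
  ...   | false = count-filterᵇ P W xs

module _ {A B : Set} where

  count-map : ∀ (P : B → Bool) (f : A → B) xs → count P (map f xs) ≡ count (P ∘ f) xs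
  count-map P f [] = refl
  count-map P f (x ∷ xs) with P (f x)
  ... | true  = cong suc (count-map P f xs)
  ... | false = count-map P f xs

module _ {A : Set} where

  lookup-injective : ∀ {xs : List A} → Unique xs → ∀ i j → lookup xs i ≡ lookup xs j → i ≡ j
  lookup-injective (_ ∷ _)  zero    zero    _  = refl
  lookup-injective (x∉ ∷ _) zero    (suc j) eq = ⊥-elim (All.lookup x∉ (∈-lookup j) eq)
  lookup-injective (x∉ ∷ _) (suc i) zero    eq = ⊥-elim (All.lookup x∉ (∈-lookup i) (sym eq))
  lookup-injective (_ ∷ un) (suc i) (suc j) eq = cong suc (lookup-injective un i j eq)

  module _ (_≟_ : DecidableEquality A) where
    open import Data.List.Membership.DecPropositional _≟_ using (_∈?_; _∉?_)

    -- Pigeonhole: pairwise disjoint lists are hit at distinct positions of ys.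
    ∃-disjoint : ∀ {m} (vs : Fin m → List A) → (∀ a b → a ≢ b → Disjoint (vs a) (vs b)) →
                 ∀ {ys} → length ys < m → ∃ λ a → Disjoint (vs a) ys
    ∃-disjoint {m} vs pairwise {ys} ys<m with Fin.any? (λ a → All.all? (_∉? ys) (vs a))
    ... | yes (a , avoids) = a , λ (x∈vs , x∈ys) → All.lookup avoids x∈vs x∈ys
    ... | no  none         = contradiction (Fin.injective⇒≤ position-injective) (<⇒≱ ys<m)
      where
      hit : ∀ a → ∃ λ x → x ∈ vs a × x ∈ ys
      hit a = find (Any.map (decidable-stable (_ ∈? ys))
                            (¬All⇒Any¬ (_∉? ys) (vs a) λ avoids → none (a , avoids)))
      position : Fin m → Fin (length ys)
      position a = index (proj₂ (proj₂ (hit a)))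
      position-injective : ∀ {a b} → position a ≡ position b → a ≡ b
      position-injective {a} {b} eq with a Fin.≟ b
      ... | yes a≡b = a≡b
      ... | no  a≢b = ⊥-elim (pairwise a b a≢b (x∈vs a , subst (_∈ vs b) (sym same-hit) (x∈vs b)))
        where
        x∈vs : ∀ c → proj₁ (hit c) ∈ vs c
        x∈vs c = proj₁ (proj₂ (hit c))
        same-hit : proj₁ (hit a) ≡ proj₁ (hit b)
        same-hit = trans (lookup-index (proj₂ (proj₂ (hit a))))
                         (trans (cong (lookup ys) eq) (sym (lookup-index (proj₂ (proj₂ (hit b))))))

    ∃∉ : ∀ {xs ys} → Unique xs → length ys < length xs → ∃ λ x → x ∈ xs × x ∉ ys
    ∃∉ {xs} unique ys<xs with ∃-disjoint (λ i → lookup xs i ∷ []) singletons-disjoint ys<xs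
      where
      singletons-disjoint : ∀ i j → i ≢ j → Disjoint (lookup xs i ∷ []) (lookup xs j ∷ [])
      singletons-disjoint i j i≢j (here refl , here eq) = i≢j (lookup-injective unique i j eq)
    ... | i , avoids = lookup xs i , ∈-lookup i , λ x∈ys → avoids (here refl , x∈ys)

  ⋃ : ∀ {m} → (Fin m → List A) → List A
  ⋃ {zero}  f = []
  ⋃ {suc m} f = f zero ++ ⋃ (f ∘ suc)

  ∈-⋃⁺ : ∀ {m} (f : Fin m → List A) {a x} → x ∈ f a → x ∈ ⋃ f
  ∈-⋃⁺ f {zero}  x∈fa = ∈-++⁺ˡ x∈fa
  ∈-⋃⁺ f {suc a} x∈fa = ∈-++⁺ʳ (f zero) (∈-⋃⁺ (f ∘ suc) x∈fa)

  ∈-⋃⁻ : ∀ {m} (f : Fin m → List A) {x} → x ∈ ⋃ f → ∃ λ a → x ∈ f a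
  ∈-⋃⁻ {suc m} f x∈⋃ with ∈-++⁻ (f zero) x∈⋃
  ... | inj₁ x∈f₀ = zero , x∈f₀
  ... | inj₂ x∈⋃′ = let a , x∈fa = ∈-⋃⁻ (f ∘ suc) x∈⋃′ in suc a , x∈fa

  ⋃-disjoint : ∀ {m} (f : Fin m → List A) {ys} → (∀ a → Disjoint (f a) ys) → Disjoint (⋃ f) ys
  ⋃-disjoint f disjoint (x∈⋃ , x∈ys) = let a , x∈fa = ∈-⋃⁻ f x∈⋃ in disjoint a (x∈fa , x∈ys)

  length-⋃≤ : ∀ {m} (f : Fin m → List A) {s} → (∀ a → length (f a) ≤ s) → length (⋃ f) ≤ m * s
  length-⋃≤ {zero}  f bound = z≤n
  length-⋃≤ {suc m} f bound = begin
    length (f zero ++ ⋃ (f ∘ suc))         ≡⟨ List.length-++ (f zero) ⟩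
    length (f zero) + length (⋃ (f ∘ suc)) ≤⟨ +-mono-≤ (bound zero) (length-⋃≤ (f ∘ suc) (bound ∘ suc)) ⟩
    suc m * _                              ∎
    where open ≤-Reasoning

  chooseDisjoint : ∀ {s M} m {Obj : Fin m → Set} (vs : ∀ a → Obj a → List A) →
    (∀ a o → length (vs a o) ≤ s) →
    (∀ a ys → length ys + s ≤ M → Σ (Obj a) λ o → Disjoint (vs a o) ys) →
    ∀ xs → length xs + m * s ≤ M →
    Σ (∀ a → Obj a) λ o → (∀ a → Disjoint (vs a (o a)) xs)
                        × (∀ a b → a ≢ b → Disjoint (vs a (o a)) (vs b (o b)))
  chooseDisjoint zero vs bound choose xs budget = (λ ()) , (λ ()) , λ ()
  chooseDisjoint {s} {M} (suc m) vs bound choose xs budget = o , avoids , pairwise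
    where
    first : Σ _ λ o → Disjoint (vs zero o) xs
    first = choose zero xs (≤-trans (+-monoʳ-≤ (length xs) (m≤m+n s (m * s))) budget)
    chosen : List A
    chosen = vs zero (proj₁ first)
    budget′ : length (chosen ++ xs) + m * s ≤ M
    budget′ = begin
      length (chosen ++ xs) + m * s     ≡⟨ cong (_+ m * s) (List.length-++ chosen) ⟩
      length chosen + length xs + m * s ≤⟨ +-monoˡ-≤ (m * s) (+-monoˡ-≤ (length xs) (bound zero _)) ⟩
      s + length xs + m * s             ≡⟨ rearrange s (length xs) (m * s) ⟩
      length xs + (s + m * s)           ≤⟨ budget ⟩
      M                                 ∎
      where
      open ≤-Reasoning
      rearrange : ∀ a b c → a + b + c ≡ b + (a + c)
      rearrange = solve-∀
    rest = chooseDisjoint m (vs ∘ suc) (bound ∘ suc) (choose ∘ suc) (chosen ++ xs) budget′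
    rest-avoids = proj₁ (proj₂ rest)
    o : ∀ a → _
    o zero    = proj₁ first
    o (suc a) = proj₁ rest a
    avoids : ∀ a → Disjoint (vs a (o a)) xs
    avoids zero    = proj₂ first
    avoids (suc a) (x∈ , x∈xs) = rest-avoids a (x∈ , ∈-++⁺ʳ chosen x∈xs)
    pairwise : ∀ a b → a ≢ b → Disjoint (vs a (o a)) (vs b (o b))
    pairwise zero    zero    a≢b = ⊥-elim (a≢b refl)
    pairwise zero    (suc b) _   (x∈ , x∈′) = rest-avoids b (x∈′ , ∈-++⁺ˡ x∈)
    pairwise (suc a) zero    _   (x∈ , x∈′) = rest-avoids a (x∈ , ∈-++⁺ˡ x∈′)
    pairwise (suc a) (suc b) a≢b = proj₂ (proj₂ rest) a b (a≢b ∘ cong suc)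

Unique⇒length≤ : ∀ {m} {xs : List (Fin m)} → Unique xs → length xs ≤ m
Unique⇒length≤ {m} {xs} unique with length xs ≤? m
... | yes ≤m = ≤m
... | no  ≰m =
  let _ , _ , ∉allFin = ∃∉ Fin._≟_ unique (subst (_< length xs) (sym |allFin|) (≰⇒> ≰m))
  in ⊥-elim (∉allFin (∈-allFin _))
  where
  |allFin| : length (allFin m) ≡ m
  |allFin| = List.length-tabulate (λ i → i)

arm-injective : ∀ {k L g h i j} {i<k : i < k} {j<k : j < k} →
                _≡_ {A = SV k L} (arm g i i<k) (arm h j j<k) → g ≡ h × i ≡ j
arm-injective refl = refl , refl

module _ {A : Set} {k L : ℕ} (σ : SV k L → A) where

  armVertices : Fin L → List A
  armVertices g = map (λ i → σ (arm g (toℕ i) (Fin.toℕ<n i))) (allFin k)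

  length-armVertices : ∀ g → length (armVertices g) ≡ k
  length-armVertices g = trans (List.length-map _ (allFin k)) (List.length-tabulate (λ i → i))

  ∈-armVertices : ∀ g j (j<k : j < k) → σ (arm g j j<k) ∈ armVertices g
  ∈-armVertices g j j<k =
    subst (_∈ armVertices g) (cong σ (same-arm (Fin.toℕ-fromℕ< j<k)))
          (∈-map⁺ _ (∈-allFin (fromℕ< j<k)))
    where
    same-arm : ∀ {i} {i<k : i < k} → i ≡ j → arm g i i<k ≡ arm g j j<k
    same-arm refl = cong (arm g j) (<-irrelevant _ _)

  arms-disjoint : Injective _≡_ _≡_ σ → ∀ g h → g ≢ h → Disjoint (armVertices g) (armVertices h)
  arms-disjoint σ-injective g h g≢h (x∈g , x∈h) with ∈-map⁻ _ x∈g | ∈-map⁻ _ x∈h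
  ... | _ , _ , refl | _ , _ , x≡ = g≢h (proj₁ (arm-injective (σ-injective x≡)))

treeSize : ℕ → ℕ → ℕ
treeSize ℓ zero    = 1
treeSize ℓ (suc j) = suc (ℓ * treeSize ℓ j)

legsSize : ℕ → ℕ → ℕ → ℕ
legsSize ℓ k zero    = ℓ * k
legsSize ℓ k (suc j) = ℓ * legsSize ℓ k j

0<treeSize : ∀ ℓ j → 0 < treeSize ℓ j
0<treeSize ℓ zero    = s≤s z≤n
0<treeSize ℓ (suc j) = s≤s z≤n

legsSize≡ : ∀ ℓ k j → legsSize ℓ k j ≡ ℓ ^ j * (ℓ * k)
legsSize≡ ℓ k zero    = sym (*-identityˡ (ℓ * k))
legsSize≡ ℓ k (suc j) = trans (cong (ℓ *_) (legsSize≡ ℓ k j)) (sym (*-assoc ℓ (ℓ ^ j) (ℓ * k)))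

module _ {ℓ : ℕ} (2≤ℓ : 2 ≤ ℓ) where

  treeSize<2ℓ^ : ∀ j → treeSize ℓ j < 2 * ℓ ^ j
  treeSize<2ℓ^ zero    = s≤s (s≤s z≤n)
  treeSize<2ℓ^ (suc j) = begin
    2 + ℓ * treeSize ℓ j   ≡⟨ +-comm 2 (ℓ * treeSize ℓ j) ⟩
    ℓ * treeSize ℓ j + 2   ≤⟨ +-monoʳ-≤ (ℓ * treeSize ℓ j) 2≤ℓ ⟩
    ℓ * treeSize ℓ j + ℓ   ≡⟨ +-comm (ℓ * treeSize ℓ j) ℓ ⟩
    ℓ + ℓ * treeSize ℓ j   ≡⟨ *-suc ℓ (treeSize ℓ j) ⟨
    ℓ * suc (treeSize ℓ j) ≤⟨ *-monoʳ-≤ ℓ (treeSize<2ℓ^ j) ⟩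
    ℓ * (2 * ℓ ^ j)        ≡⟨ swap ℓ (ℓ ^ j) ⟩
    2 * (ℓ * ℓ ^ j)        ∎
    where
    open ≤-Reasoning
    swap : ∀ a b → a * (2 * b) ≡ 2 * (a * b)
    swap = solve-∀

  k*treeSize≤ : ∀ k → k * treeSize ℓ k ≤ 2 * k * ℓ ^ k
  k*treeSize≤ k = ≤-trans (*-monoʳ-≤ k (<⇒≤ (treeSize<2ℓ^ k))) (≤-reflexive (swap k (ℓ ^ k)))
    where
    swap : ∀ a b → a * (2 * b) ≡ 2 * a * b
    swap = solve-∀

  treeSize+legsSize≤ : ∀ {k} → 1 ≤ k → treeSize ℓ k + legsSize ℓ k k ≤ 3 * k * ℓ ^ (k + 1)
  treeSize+legsSize≤ {k} 1≤k = begin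
    treeSize ℓ k + legsSize ℓ k k ≤⟨ +-mono-≤ (<⇒≤ (treeSize<2ℓ^ k)) (≤-reflexive (legsSize≡ ℓ k k)) ⟩
    2 * P + P * (ℓ * k)           ≤⟨ +-monoˡ-≤ _ (*-monoˡ-≤ P (*-monoʳ-≤ 2 1≤kℓ)) ⟩
    2 * (k * ℓ) * P + P * (ℓ * k) ≡⟨ collect k ℓ P ⟩
    3 * k * (ℓ * P)               ≡⟨ cong (λ e → 3 * k * ℓ ^ e) (+-comm 1 k) ⟩
    3 * k * ℓ ^ (k + 1)           ∎
    where
    open ≤-Reasoning
    P = ℓ ^ k
    1≤kℓ : 1 ≤ k * ℓ
    1≤kℓ = *-mono-≤ 1≤k (≤-trans (s≤s z≤n) 2≤ℓ)
    collect : ∀ a b c → 2 * (a * b) * c + c * (b * a) ≡ 3 * a * (b * c)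
    collect = solve-∀

module _ (G : Digraph) where

  Vertex : Set
  Vertex = Fin (n G)

  _⟶_ : Vertex → Vertex → Set
  u ⟶ v = adj G u v ≡ true

  degIn : Vertex → (Vertex → Bool) → ℕ
  degIn v W = count (λ u → W u ∧ adj G v u) (allFin (n G))

  outdeg≡degIn : ∀ v → outdeg G v ≡ degIn v (λ _ → true)
  outdeg≡degIn v = sum-indicator≡count (adj G v) (allFin (n G))

  neighbourOutside : ∀ {v W ys} → length ys < degIn v W → ∃ λ u → T (W u) × v ⟶ u × u ∉ ys
  neighbourOutside {v} {W} ys<deg =
    let u , u∈N , u∉ys = ∃∉ Fin._≟_ (Unique.filter⁺ (T? ∘ N) (Unique.allFin⁺ (n G))) ys<deg
        u∈W , v⟶u     = Equivalence.to T-∧ (proj₂ (∈-filter⁻ (T? ∘ N) {xs = allFin (n G)} u∈N))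
    in u , u∈W , Equivalence.to T-≡ v⟶u , u∉ys
    where
    N : Vertex → Bool
    N u = W u ∧ adj G v u

  -- The hypothesis is applied to the induced subgraph G[W], whose vertices are
  -- enumerated by filtering.
  embedInside : ∀ {P : Set} {E : P → P → Set} (W : Vertex → Bool) {d} →
    ∃ (T ∘ W) → (∀ v → T (W v) → d ≤ degIn v W) →
    ((H : Digraph) → MinOutDeg≥ H d → Contains H P E) →
    Σ (Contains G P E) λ φ → ∀ x → T (W (proj₁ φ x))
  embedInside W (w , w∈W) dense contains =
    let ψ , ψ-injective , ψ-edge = contains H minDegH
    in (e ∘ ψ , ψ-injective ∘ e-injective , ψ-edge) , e∈W ∘ ψ
    where
    ws : List Vertex
    ws = filterᵇ W (allFin (n G))
    e : Fin (length ws) → Vertex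
    e = lookup ws
    e-injective : ∀ {i j} → e i ≡ e j → i ≡ j
    e-injective = lookup-injective (Unique.filter⁺ (T? ∘ W) (Unique.allFin⁺ (n G))) _ _
    e∈W : ∀ i → T (W (e i))
    e∈W i = proj₂ (∈-filter⁻ (T? ∘ W) {xs = allFin (n G)} (∈-lookup i))
    H : Digraph
    H = record
      { n        = length ws
      ; nonempty = ≤-trans (s≤s z≤n) (Fin.toℕ<n (index (∈-filter⁺ (T? ∘ W) (∈-allFin w) w∈W)))
      ; adj      = λ i j → adj G (e i) (e j)
      ; loopless = loopless G ∘ e
      }
    outdegH : ∀ i → outdeg H i ≡ degIn (e i) W
    outdegH i = begin
      outdeg H i                           ≡⟨ sum-indicator≡count (adj H i) (allFin (length ws)) ⟩
      count (Nᵢ ∘ e) (allFin (length ws))  ≡⟨ count-map Nᵢ e (allFin (length ws)) ⟨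
      count Nᵢ (map e (allFin (length ws))) ≡⟨ cong (count Nᵢ) (List.map-tabulate (λ j → j) e) ⟩
      count Nᵢ (tabulate e)                ≡⟨ cong (count Nᵢ) (List.tabulate-lookup ws) ⟩
      count Nᵢ ws                          ≡⟨ count-filterᵇ Nᵢ W (allFin (n G)) ⟩
      degIn (e i) W                        ∎
      where
      open ≡-Reasoning
      Nᵢ = adj G (e i)
    minDegH : MinOutDeg≥ H _
    minDegH i = ≤-trans (dense (e i) (e∈W i)) (≤-reflexive (sym (outdegH i)))

  Star : ℕ → ℕ → Vertex → Set
  Star k L c = Σ (Contains G (SV k L) (SE k L)) λ σ → proj₁ σ centre ≡ c

  module Layers (C : List Vertex) (t : ℕ) where
    open import Data.List.Membership.DecPropositional (Fin._≟_ {n G}) using (_∈?_)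

    layer : ℕ → Vertex → Bool
    layer zero    v = isYes (v ∈? C)
    layer (suc j) v = t ≤ᵇ degIn v (layer j)

    inLayers : ℕ → ℕ → Vertex → Bool
    inLayers m zero    v = false
    inLayers m (suc r) v = layer m v ∨ inLayers (suc m) r v

    centre∈layers : ∀ j {c} → 1 ≤ j → c ∈ C → T (inLayers 0 j c)
    centre∈layers (suc j) {c} _ c∈C = ∨-introˡ (inLayers 1 j c) (fromWitness c∈C)

    ∉layers-snoc : ∀ m r {v} → ¬ T (inLayers m r v) → ¬ T (layer (m + r) v) → ¬ T (inLayers m (suc r) v)
    ∉layers-snoc m zero {v} _ ∉top v∈ =
      ∉top (subst (λ j → T (layer j v)) (sym (+-identityʳ m)) (subst T (∨-identityʳ _) v∈))
    ∉layers-snoc m (suc r) {v} ∉lay ∉top v∈ with Equivalence.to (T-∨ {layer m v}) v∈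
    ... | inj₁ v∈m    = ∉lay (∨-introˡ _ v∈m)
    ... | inj₂ v∈rest = ∉layers-snoc (suc m) r (∉lay ∘ ∨-introʳ (layer m v))
                          (∉top ∘ subst (λ j → T (layer j v)) (sym (+-suc m r))) v∈rest

    ∉layers-shift : ∀ j {v} → ¬ T (inLayers 0 j v) → ¬ T (layer j v) → ¬ T (inLayers 1 j v)
    ∉layers-shift zero    _   _    ()
    ∉layers-shift (suc j) {v} ∉lay ∉top = ∉layers-snoc 1 j (∉lay ∘ ∨-introʳ (layer 0 v)) ∉top

    -- Outside layers m + 1, …, m + r, a vertex has fewer than t out-neighbours in each
    -- of the layers m, …, m + r − 1.
    degree-split : ∀ m r {v} → ¬ T (inLayers (suc m) r v) →
                   outdeg G v + r ≤ degIn v (not ∘ inLayers m r) + r * t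
    degree-split m zero {v} _ = ≤-reflexive (cong (_+ 0) (outdeg≡degIn v))
    degree-split m (suc r) {v} ∉lay = begin
      outdeg G v + suc r               ≡⟨ +-suc (outdeg G v) r ⟩
      suc (outdeg G v + r)             ≤⟨ s≤s (degree-split (suc m) r (∉lay ∘ ∨-introʳ (layer (suc m) v))) ⟩
      suc (degIn v (not ∘ Zᵣ) + r * t) ≤⟨ s≤s (+-monoˡ-≤ (r * t) split) ⟩
      suc (outside + inLayer + r * t)  ≡⟨ rearrange outside inLayer (r * t) ⟩
      outside + (suc inLayer + r * t)  ≤⟨ +-monoʳ-≤ outside (+-monoˡ-≤ (r * t) sparse) ⟩
      outside + (t + r * t)            ∎
      where
      open ≤-Reasoning
      Zᵣ = inLayers (suc m) r
      outside = degIn v (not ∘ inLayers m (suc r))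
      inLayer = degIn v (layer m)
      sparse : inLayer < t
      sparse = ≰⇒> (∉lay ∘ ∨-introˡ _ ∘ ≤⇒≤ᵇ)
      split : degIn v (not ∘ Zᵣ) ≤ outside + inLayer
      split = count-⇒∨ (allFin (n G)) λ u → pointwise (layer m u) (Zᵣ u) (adj G v u)
        where
        pointwise : ∀ a b c → T (not b ∧ c) → T ((not (a ∨ b) ∧ c) ∨ (a ∧ c))
        pointwise _     true  _     ()
        pointwise _     false false ()
        pointwise true  false true  _ = tt
        pointwise false false true  _ = tt
      rearrange : ∀ a b c → suc (a + b + c) ≡ a + (suc b + c)
      rearrange = solve-∀

    module TopLayerEmpty (k d : ℕ) (minDeg : MinOutDeg≥ G (d + k * t)) (top-empty : ∀ v → ¬ T (layer k v))
      where

      unlayered : Vertex → Bool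
      unlayered v = not (inLayers 0 k v)

      -- Covering by layers m, …, k − 1 forces covering by layers m + 1, …, k − 1.
      layers-cannot-cover : ∀ r m → m + r ≡ k → ¬ (∀ v → T (inLayers m r v))
      layers-cannot-cover zero    m _         covered = covered (fromℕ< (nonempty G))
      layers-cannot-cover (suc r) m m+r+1≡k covered = layers-cannot-cover r (suc m) m+1+r≡k covered′
        where
        m+1+r≡k : suc m + r ≡ k
        m+1+r≡k = trans (sym (+-suc m r)) m+r+1≡k
        covered′ : ∀ v → T (inLayers (suc m) r v)
        covered′ v with T? (inLayers (suc m) r v)
        ... | yes v∈ = v∈
        ... | no  v∉ = contradiction (≤-trans split minDeg′) (m+1+n≰m (outdeg G v))
          where
          v∉′ : ¬ T (inLayers (suc m) (suc r) v)
          v∉′ = ∉layers-snoc (suc m) r v∉ (subst (λ j → ¬ T (layer j v)) (sym m+1+r≡k) (top-empty v))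
          no-room : degIn v (not ∘ inLayers m (suc r)) ≡ 0
          no-room = count-none (allFin (n G)) λ u → not-∧-absurd (covered u)
          split : outdeg G v + suc r ≤ suc r * t
          split = subst (λ x → outdeg G v + suc r ≤ x + suc r * t) no-room (degree-split m (suc r) v∉′)
          minDeg′ : suc r * t ≤ outdeg G v
          minDeg′ = ≤-trans (*-monoˡ-≤ t (≤-trans (m≤n+m (suc r) m) (≤-reflexive m+r+1≡k)))
                            (≤-trans (m≤n+m (k * t) d) (minDeg v))

      unlayered-nonempty : ∃ (T ∘ unlayered)
      unlayered-nonempty with Fin.any? (λ v → T? (unlayered v))
      ... | yes found = found
      ... | no  none  = ⊥-elim (layers-cannot-cover k 0 refl λ v → ¬T-not⇒T (λ v∉ → none (v , v∉)))

      unlayered-degree : ∀ v → T (unlayered v) → d ≤ degIn v unlayered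
      unlayered-degree v v∉ = +-cancelʳ-≤ (k * t) d (degIn v unlayered) (begin
        d + k * t                 ≤⟨ minDeg v ⟩
        outdeg G v                ≤⟨ m≤m+n (outdeg G v) k ⟩
        outdeg G v + k            ≤⟨ degree-split 0 k (∉layers-shift k (T-not⇒¬T v∉) (top-empty v)) ⟩
        degIn v unlayered + k * t ∎)
        where open ≤-Reasoning

      embedOutside : ∀ {P : Set} {E : P → P → Set} → 1 ≤ k →
        ((H : Digraph) → MinOutDeg≥ H d → Contains H P E) →
        Σ (Contains G P E) λ φ → ∀ x → proj₁ φ x ∉ C
      embedOutside 1≤k contains =
        let φ , unlayered-image = embedInside unlayered unlayered-nonempty unlayered-degree contains
        in φ , λ x → T-not⇒¬T (unlayered-image x) ∘ centre∈layers k 1≤k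

  module Trees (C : List Vertex) (t ℓ : ℕ) where
    open Layers C t

    data Tree : ℕ → Set where
      leaf : (v : Vertex) → v ∈ C → Tree zero
      node : ∀ {j} → Vertex → (Fin ℓ → Tree j) → Tree (suc j)

    root : ∀ {j} → Tree j → Vertex
    root (leaf v _) = v
    root (node v _) = v

    nodes : ∀ {j} → Tree j → List Vertex
    nodes (leaf v _)  = v ∷ []
    nodes (node v ts) = v ∷ ⋃ (nodes ∘ ts)

    Proper : ∀ {j} → Tree j → Set
    Proper (leaf _ _)  = ⊤
    Proper (node v ts) = (∀ a → v ⟶ root (ts a)) × (∀ a → Proper (ts a)) × (∀ a → v ∉ nodes (ts a))
                       × (∀ a b → a ≢ b → Disjoint (nodes (ts a)) (nodes (ts b)))

    -- A vertex of layer j has t out-neighbours in layer j − 1, enough to pick ℓ children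
    -- avoiding the at most t vertices already used.
    growTree : ∀ j v → T (layer j v) → ∀ xs → v ∉ xs → length xs + treeSize ℓ j ≤ t →
               Σ (Tree j) λ τ → root τ ≡ v × Proper τ × Disjoint (nodes τ) xs
                               × length (nodes τ) ≤ treeSize ℓ j
    growTree zero v v∈C xs v∉xs _ = leaf v (toWitness v∈C) , refl , tt , avoids , ≤-refl
      where
      avoids : Disjoint (v ∷ []) xs
      avoids (here refl , v∈xs) = v∉xs v∈xs
    growTree (suc j) v v∈layer xs v∉xs budget =
      let budget′ = ≤-trans (≤-reflexive (sym (+-suc (length xs) _))) budget
          children , avoid , pairwise = chooseDisjoint ℓ (λ _ → nodes ∘ Child.subtree) (λ _ → Child.small)
                                          grow (v ∷ xs) budget′
          τ = node v (Child.subtree ∘ children)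
          avoids : Disjoint (nodes τ) xs
          avoids = λ where
            (here refl , v∈xs) → v∉xs v∈xs
            (there x∈ , x∈xs)  → ⋃-disjoint _ (λ a (x∈a , x∈xs) → avoid a (x∈a , there x∈xs)) (x∈ , x∈xs)
          proper : Proper τ
          proper = Child.edge ∘ children , Child.proper ∘ children
                 , (λ a v∈ → avoid a (v∈ , here refl)) , pairwise
      in τ , refl , proper , avoids , s≤s (length-⋃≤ _ (Child.small ∘ children))
      where
      record Child : Set where
        field
          subtree : Tree j
          edge    : v ⟶ root subtree
          proper  : Proper subtree
          small   : length (nodes subtree) ≤ treeSize ℓ j
      grow : Fin ℓ → ∀ ys → length ys + treeSize ℓ j ≤ t →
             Σ Child λ c → Disjoint (nodes (Child.subtree c)) ys
      grow _ ys budget′ =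
        let u , u∈layer , v⟶u , u∉ys              = neighbourOutside {v} {layer j} {ys} room
            τ , root≡u , proper , avoids , small = growTree j u u∈layer ys u∉ys budget′
        in record { subtree = τ ; edge = subst (v ⟶_) (sym root≡u) v⟶u ; proper = proper ; small = small }
         , avoids
        where
        room : length ys < degIn v (layer j)
        room = begin-strict
          length ys                <⟨ m<m+n (length ys) (0<treeSize ℓ j) ⟩
          length ys + treeSize ℓ j ≤⟨ budget′ ⟩
          t                        ≤⟨ ≤ᵇ⇒≤ t _ v∈layer ⟩
          degIn v (layer j)        ∎
          where open ≤-Reasoning

    -- Paths running past a leaf stop there.
    vertexAt : ∀ {j} → Tree j → List (Fin ℓ) → Vertex
    vertexAt (leaf v _)  _        = v
    vertexAt (node v _)  []       = v
    vertexAt (node _ ts) (a ∷ as) = vertexAt (ts a) as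

    vertexAt-∈ : ∀ {j} (τ : Tree j) as → vertexAt τ as ∈ nodes τ
    vertexAt-∈ (leaf _ _)  _        = here refl
    vertexAt-∈ (node _ _)  []       = here refl
    vertexAt-∈ (node _ ts) (a ∷ as) = there (∈-⋃⁺ (nodes ∘ ts) (vertexAt-∈ (ts a) as))

    vertexAt-injective : ∀ {j} (τ : Tree j) → Proper τ → ∀ as bs → length as ≤ j → length bs ≤ j →
                         vertexAt τ as ≡ vertexAt τ bs → as ≡ bs
    vertexAt-injective (leaf _ _)  _ [] [] _ _ _ = refl
    vertexAt-injective (node _ _)  _ [] [] _ _ _ = refl
    vertexAt-injective (node _ ts) (_ , _ , v∉ , _) [] (b ∷ bs) _ _ eq =
      ⊥-elim (v∉ b (subst (_∈ nodes (ts b)) (sym eq) (vertexAt-∈ (ts b) bs)))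
    vertexAt-injective (node _ ts) (_ , _ , v∉ , _) (a ∷ as) [] _ _ eq =
      ⊥-elim (v∉ a (subst (_∈ nodes (ts a)) eq (vertexAt-∈ (ts a) as)))
    vertexAt-injective (node _ ts) (_ , proper , _ , disjoint) (a ∷ as) (b ∷ bs) (s≤s |as|≤) (s≤s |bs|≤) eq
      with a Fin.≟ b
    ... | yes refl = cong (a ∷_) (vertexAt-injective (ts a) (proper a) as bs |as|≤ |bs|≤ eq)
    ... | no  a≢b  = ⊥-elim (disjoint a b a≢b
                       (vertexAt-∈ (ts a) as , subst (_∈ nodes (ts b)) (sym eq) (vertexAt-∈ (ts b) bs)))

    vertexAt-edge : ∀ {j} (τ : Tree j) → Proper τ → ∀ as a → length as < j →
                    vertexAt τ as ⟶ vertexAt τ (as ++ a ∷ [])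
    vertexAt-edge (node v ts) (edge , _) [] a _ = subst (v ⟶_) (root≡vertexAt (ts a)) (edge a)
      where
      root≡vertexAt : ∀ {j} (τ : Tree j) → root τ ≡ vertexAt τ []
      root≡vertexAt (leaf _ _) = refl
      root≡vertexAt (node _ _) = refl
    vertexAt-edge (node _ ts) (_ , proper , _) (b ∷ as) a (s≤s |as|<) = vertexAt-edge (ts b) (proper b) as a |as|<

    module WithStars (k L : ℕ) (stars : All (Star k L) C) where

      starAt : ∀ {v} → v ∈ C → SV k L → Vertex
      starAt v∈C = proj₁ (proj₁ (All.lookup stars v∈C))

      starAt-injective : ∀ {v} (v∈C : v ∈ C) → Injective _≡_ _≡_ (starAt v∈C)
      starAt-injective v∈C = proj₁ (proj₂ (proj₁ (All.lookup stars v∈C)))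

      -- At every leaf, the indices of the ℓ arms of its star that serve as legs.
      Legs : ∀ {j} → Tree j → Set
      Legs (leaf _ _)  = Fin ℓ → Fin L
      Legs (node _ ts) = (a : Fin ℓ) → Legs (ts a)

      legNodes : ∀ {j} (τ : Tree j) → Legs τ → List Vertex
      legNodes (leaf _ v∈C) ls = ⋃ (armVertices (starAt v∈C) ∘ ls)
      legNodes (node _ ts)  ls = ⋃ λ a → legNodes (ts a) (ls a)

      ProperLegs : ∀ {j} (τ : Tree j) → Legs τ → Set
      ProperLegs (leaf _ v∈C) ls =
        ∀ b c → b ≢ c → Disjoint (armVertices (starAt v∈C) (ls b)) (armVertices (starAt v∈C) (ls c))
      ProperLegs (node _ ts)  ls =
        (∀ a → ProperLegs (ts a) (ls a)) ×
        (∀ a b → a ≢ b → Disjoint (legNodes (ts a) (ls a)) (legNodes (ts b) (ls b)))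

      -- The arms of a star are disjoint, so fewer than L used vertices leave an arm untouched.
      growLegs : 1 ≤ k → ∀ {j} (τ : Tree j) xs → length xs + legsSize ℓ k j ≤ L →
                 Σ (Legs τ) λ ls → ProperLegs τ ls × Disjoint (legNodes τ ls) xs
                                 × length (legNodes τ ls) ≤ legsSize ℓ k j
      growLegs 1≤k (leaf v v∈C) xs budget =
        let ls , avoid , pairwise = chooseDisjoint ℓ (λ _ → armVertices σ)
                                      (λ _ → ≤-reflexive ∘ length-armVertices σ) pick xs budget
        in ls , pairwise , ⋃-disjoint _ avoid , length-⋃≤ _ (≤-reflexive ∘ length-armVertices σ ∘ ls)
        where
        σ = starAt v∈C
        pick : Fin ℓ → ∀ ys → length ys + k ≤ L → ∃ λ g → Disjoint (armVertices σ g) ys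
        pick _ ys budget′ = ∃-disjoint Fin._≟_ (armVertices σ) (arms-disjoint σ (starAt-injective v∈C))
                              (<-≤-trans (m<m+n (length ys) 1≤k) budget′)
      growLegs 1≤k {suc j} (node _ ts) xs budget =
        let decorated , avoid , pairwise = chooseDisjoint ℓ (λ a → legNodes (ts a) ∘ Decorated.legs)
                                             (λ _ → Decorated.small) grow xs budget
        in Decorated.legs ∘ decorated , (Decorated.proper ∘ decorated , pairwise) , ⋃-disjoint _ avoid
         , length-⋃≤ _ (Decorated.small ∘ decorated)
        where
        record Decorated (a : Fin ℓ) : Set where
          field
            legs   : Legs (ts a)
            proper : ProperLegs (ts a) legs
            small  : length (legNodes (ts a) legs) ≤ legsSize ℓ k j
        grow : ∀ a ys → length ys + legsSize ℓ k j ≤ L →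
               Σ (Decorated a) λ d → Disjoint (legNodes (ts a) (Decorated.legs d)) ys
        grow a ys budget′ = let ls , proper , avoids , small = growLegs 1≤k (ts a) ys budget′
                            in record { legs = ls ; proper = proper ; small = small } , avoids

      legAt : ∀ {j} (τ : Tree j) → Legs τ → (as : List (Fin ℓ)) → length as ≡ j →
              Fin ℓ → (i : ℕ) → i < k → Vertex
      legAt (leaf _ v∈C) ls []       _     b i i<k = starAt v∈C (arm (ls b) i i<k)
      legAt (node _ ts)  ls (a ∷ as) |as|≡ b i i<k = legAt (ts a) (ls a) as (suc-injective |as|≡) b i i<k

      legAt-∈ : ∀ {j} (τ : Tree j) ls as |as|≡ b i i<k → legAt τ ls as |as|≡ b i i<k ∈ legNodes τ ls
      legAt-∈ (leaf _ v∈C) ls [] _ b i i<k =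
        ∈-⋃⁺ (armVertices (starAt v∈C) ∘ ls) (∈-armVertices (starAt v∈C) (ls b) i i<k)
      legAt-∈ (node _ ts) ls (a ∷ as) |as|≡ b i i<k =
        ∈-⋃⁺ (λ a → legNodes (ts a) (ls a)) (legAt-∈ (ts a) (ls a) as (suc-injective |as|≡) b i i<k)

      legAt-injective : ∀ {j} (τ : Tree j) ls → ProperLegs τ ls →
        ∀ as bs |as|≡ |bs|≡ b c i i′ i<k i′<k →
        legAt τ ls as |as|≡ b i i<k ≡ legAt τ ls bs |bs|≡ c i′ i′<k → as ≡ bs × b ≡ c × i ≡ i′
      legAt-injective (leaf _ v∈C) ls disjoint [] [] _ _ b c i i′ i<k i′<k eq with b Fin.≟ c
      ... | yes refl = refl , refl , proj₂ (arm-injective (starAt-injective v∈C eq))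
      ... | no  b≢c  = ⊥-elim (disjoint b c b≢c
              (∈-armVertices σ (ls b) i i<k ,
               subst (_∈ armVertices σ (ls c)) (sym eq) (∈-armVertices σ (ls c) i′ i′<k)))
        where σ = starAt v∈C
      legAt-injective (node _ ts) ls (proper , disjoint) (a ∷ as) (a′ ∷ bs) |as|≡ |bs|≡ b c i i′ i<k i′<k eq
        with a Fin.≟ a′
      ... | yes refl =
        let as≡bs , b≡c , i≡i′ = legAt-injective (ts a) (ls a) (proper a) as bs _ _ b c i i′ i<k i′<k eq
        in cong (a ∷_) as≡bs , b≡c , i≡i′
      ... | no  a≢a′ = ⊥-elim (disjoint a a′ a≢a′
              (legAt-∈ (ts a) (ls a) as _ b i i<k ,
               subst (_∈ legNodes (ts a′) (ls a′)) (sym eq) (legAt-∈ (ts a′) (ls a′) bs _ c i′ i′<k)))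

      legAt-toLeaf : ∀ {j} (τ : Tree j) ls as |as|≡ b (0<k : 0 < k) →
                     legAt τ ls as |as|≡ b 0 0<k ⟶ vertexAt τ as
      legAt-toLeaf (leaf v v∈C) ls [] _ b 0<k with All.lookup stars v∈C
      ... | (σ , _ , σ-edge) , σ-centre =
        subst (σ (arm (ls b) 0 0<k) ⟶_) σ-centre (σ-edge (toCentre (ls b) 0<k))
      legAt-toLeaf (node _ ts) ls (a ∷ as) |as|≡ b 0<k = legAt-toLeaf (ts a) (ls a) as (suc-injective |as|≡) b 0<k

      legAt-step : ∀ {j} (τ : Tree j) ls as |as|≡ b i (i+1<k : suc i < k) (i<k : i < k) →
                   legAt τ ls as |as|≡ b (suc i) i+1<k ⟶ legAt τ ls as |as|≡ b i i<k
      legAt-step (leaf v v∈C) ls [] _ b i i+1<k i<k with All.lookup stars v∈C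
      ... | (_ , _ , σ-edge) , _ = σ-edge (step (ls b) i i+1<k i<k)
      legAt-step (node _ ts) ls (a ∷ as) |as|≡ b i i+1<k i<k =
        legAt-step (ts a) (ls a) as (suc-injective |as|≡) b i i+1<k i<k

      -- A word of TV lists the root path to its node backwards, hence the reversals.
      legged-tree⇒containsT : (τ : Tree k) → Proper τ → (ls : Legs τ) → ProperLegs τ ls →
                              Disjoint (nodes τ) (legNodes τ ls) → Contains G (TV k ℓ) (TE k ℓ)
      legged-tree⇒containsT τ proper ls proper-legs disjoint = φ , φ-injective , φ-edge
        where
        |reverse| : ∀ (w : List (Fin ℓ)) {j} → length w ≡ j → length (reverse w) ≡ j
        |reverse| w = trans (List.length-reverse w)

        φ : TV k ℓ → Vertex
        φ (node w _)           = vertexAt τ (reverse w)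
        φ (leg w |w|≡ b i i<k) = legAt τ ls (reverse w) (|reverse| w |w|≡) b i i<k

        φ-injective : Injective _≡_ _≡_ φ
        φ-injective {node w |w|≤} {node w′ |w′|≤} eq
          with List.reverse-injective {x = w} {y = w′} (vertexAt-injective τ proper (reverse w) (reverse w′)
                 (≤-trans (≤-reflexive (List.length-reverse w)) |w|≤)
                 (≤-trans (≤-reflexive (List.length-reverse w′)) |w′|≤) eq)
        ... | refl = cong (node w) (≤-irrelevant |w|≤ |w′|≤)
        φ-injective {node w _} {leg w′ _ b i i<k} eq =
          ⊥-elim (disjoint (subst (_∈ nodes τ) eq (vertexAt-∈ τ (reverse w)) ,
                            legAt-∈ τ ls (reverse w′) _ b i i<k))
        φ-injective {leg w _ b i i<k} {node w′ _} eq =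
          ⊥-elim (disjoint (subst (_∈ nodes τ) (sym eq) (vertexAt-∈ τ (reverse w′)) ,
                            legAt-∈ τ ls (reverse w) _ b i i<k))
        φ-injective {leg w |w|≡ b i i<k} {leg w′ |w′|≡ b′ i′ i′<k} eq
          with legAt-injective τ ls proper-legs (reverse w) (reverse w′) _ _ b b′ i i′ i<k i′<k eq
        ... | rev≡ , refl , refl with List.reverse-injective {x = w} {y = w′} rev≡
        ...   | refl =
          cong₂ (λ |w|≡ i<k → leg w |w|≡ b i i<k) (≡-irrelevant |w|≡ |w′|≡) (<-irrelevant i<k i′<k)

        φ-edge : ∀ {x y} → TE k ℓ x y → φ x ⟶ φ y
        φ-edge (tree w a _ |aw|≤) =
          subst (λ as → vertexAt τ (reverse w) ⟶ vertexAt τ as) (sym (List.unfold-reverse a w))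
                (vertexAt-edge τ proper (reverse w) a
                   (≤-trans (s≤s (≤-reflexive (List.length-reverse w))) |aw|≤))
        φ-edge (toLeaf w |w|≡ b 0<k _)        = legAt-toLeaf τ ls (reverse w) (|reverse| w |w|≡) b 0<k
        φ-edge (legStep w |w|≡ b i i+1<k i<k) = legAt-step τ ls (reverse w) (|reverse| w |w|≡) b i i+1<k i<k

      top-layer⇒containsT : 1 ≤ k → treeSize ℓ k ≤ t → treeSize ℓ k + legsSize ℓ k k ≤ L →
                            ∀ v → T (layer k v) → Contains G (TV k ℓ) (TE k ℓ)
      top-layer⇒containsT 1≤k tree-fits fits v v∈layer =
        let τ , _ , proper , _ , small   = growTree k v v∈layer [] (λ ()) tree-fits
            legs-fit                      = ≤-trans (+-monoˡ-≤ (legsSize ℓ k k) small) fits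
            ls , proper-legs , avoids , _ = growLegs 1≤k τ (nodes τ) legs-fit
        in legged-tree⇒containsT τ proper ls proper-legs (Disjoint-sym avoids)

  -- Each round either finds layer k nonempty or adds a new centre to the duplicate-free
  -- list C, which has at most n G entries.
  containsT : ∀ k ℓ L d → 1 ≤ k → treeSize ℓ k + legsSize ℓ k k ≤ L →
              ((H : Digraph) → MinOutDeg≥ H d → Contains H (SV k L) (SE k L)) →
              MinOutDeg≥ G (d + k * treeSize ℓ k) → Contains G (TV k ℓ) (TE k ℓ)
  containsT k ℓ L d 1≤k fits containsStar minDeg = grow (n G) [] [] [] ≤-refl
    where
    t = treeSize ℓ k
    grow : ∀ fuel (C : List Vertex) → Unique C → All (Star k L) C → n G ≤ length C + fuel →
           Contains G (TV k ℓ) (TE k ℓ)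
    grow fuel C unique stars bound with Fin.any? (λ v → T? (Layers.layer C t k v))
    ... | yes (v , v∈top) = Trees.WithStars.top-layer⇒containsT C t ℓ k L stars 1≤k ≤-refl fits v v∈top
    ... | no  top-empty
      with Layers.TopLayerEmpty.embedOutside C t k d minDeg (λ v v∈top → top-empty (v , v∈top))
             1≤k containsStar
    ...   | σ , outside = continue fuel bound
      where
      c = proj₁ σ centre
      unique′ : Unique (c ∷ C)
      unique′ = ¬Any⇒All¬ C (outside centre) ∷ unique
      continue : ∀ fuel → n G ≤ length C + fuel → Contains G (TV k ℓ) (TE k ℓ)
      continue zero bound′ =
        ⊥-elim (1+n≰n (≤-trans (Unique⇒length≤ unique′) (≤-trans bound′ (≤-reflexive (+-identityʳ _)))))
      continue (suc fuel′) bound′ =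
        grow fuel′ (c ∷ C) unique′ ((σ , refl) ∷ stars) (≤-trans bound′ (≤-reflexive (+-suc (length C) fuel′)))

theorem3p3 : (f : ℕ → ℕ → ℕ) →
    (∀ k ℓ → 1 ≤ k → 1 ≤ ℓ → (G : Digraph) → MinOutDeg≥ G (f k ℓ) → Contains G (SV k ℓ) (SE k ℓ)) →
    ∀ k ℓ → 1 ≤ k → 2 ≤ ℓ → (G : Digraph) →
    MinOutDeg≥ G (f k (3 * k * ℓ ^ (k + 1)) + 2 * k * ℓ ^ k) →
    Contains G (TV k ℓ) (TE k ℓ)
theorem3p3 f containsStar k ℓ 1≤k 2≤ℓ G minDeg =
  containsT G k ℓ L (f k L) 1≤k fits (containsStar k L 1≤k 1≤L)
    (λ v → ≤-trans (+-monoʳ-≤ (f k L) (k*treeSize≤ 2≤ℓ k)) (minDeg v))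
  where
  L = 3 * k * ℓ ^ (k + 1)
  fits : treeSize ℓ k + legsSize ℓ k k ≤ L
  fits = treeSize+legsSize≤ 2≤ℓ 1≤k
  1≤L : 1 ≤ L
  1≤L = ≤-trans (≤-trans (0<treeSize ℓ k) (m≤m+n _ _)) fits
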